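{- Let $\mathcal{T}=((t,u),\mathcal{O},\{\mathcal{R}_1,\ldots,\mathcal{R}_k\})$ be a tiling whose obstructions are pairwise incomparable under containment, let $r$ be a row and $S$ a nonempty subset of the nonempty cells of row $r$ such that row separation applies to $(r,S)$, and let $\mathcal{T}'$ be the row-separated tiling defined in the context. Then for every $n\in\mathbb{N}$, the number of gridded permutations of size $n$ in $\operatorname{Grid}(\mathcal{T})$ equals the number in $\operatorname{Grid}(\mathcal{T}')$ (row separation is an equivalence strategy). The analogous statement holds for column separation, with the roles of rows and columns exchanged.
   Context: A gridded permutation of size $n$ is a pair $(\pi,(c_1,\ldots,c_n))$ with $\pi$ a permutation of $\{1,\ldots,n\}$ and cells $c_i=(x_i,y_i)\in\mathbb{N}^2$ such that $x_i\le x_j$ whenever $i<j$ and $y_i\le y_j$ whenever $\pi(i)<\pi(j)$; $\mathcal{G}^{(t,u)}$ is the set of those with all cells in $\{0,\ldots,t-1\}\times\{0,\ldots,u-1\}$. Containment $h\le g$: some subsequence of $g$'s permutation is order-isomorphic to $h$'s permutation and the corresponding cells of $g$ equal the cells of $h$. A tiling $((t,u),\mathcal{O},\mathcal{R})$ has obstructions $\mathcal{O}$ and requirement lists $\mathcal{R}$; its set $\operatorname{Grid}$ consists of elements of $\mathcal{G}^{(t,u)}$ avoiding every obstruction and containing at least one element of each requirement list. A cell $c$ is empty if $(1,(c))\in\mathcal{O}$, nonempty otherwise. Given row $r$ and $S$, let $S'$ be the remaining nonempty cells of row $r$. Row separation applies if for every $(c_1,c_2)\in S\times S'$: if $c_1$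 is in a column left of $c_2$ then $(21,(c_1,c_2))\in\mathcal{O}$, and if $c_1$ is in a column right of $c_2$ then $(12,(c_2,c_1))\in\mathcal{O}$; these required obstructions form the set $C$ of critical row patterns. Define $\gamma(i,j)=(i,j)$ if $j<r$, or if $j=r$ and column $i$ contains a cell of $S$; $\gamma(i,j)=(i,j+1)$ if $j>r$, or if $j=r$ and column $i$ contains no cell of $S$. For a gridded permutation $(\pi,(c_1,\ldots,c_n))$ let $\Gamma((\pi,(c_1,\ldots,c_n)))=(\pi,(\gamma(c_1),\ldots,\gamma(c_n)))$, and for a set $X$ let $\Gamma(X)=\{\Gamma(x):x\in X\}$, keeping only those images that are valid (consistent) gridded permutations. Let $\mathcal{O}'=\{(1,(i,r)): 0\le i<t,\ \text{column } i \text{ contains no cell of } S\}\cup\{(1,(i,r+1)): \text{column } i \text{ contains a cell of } S\}$. The row-separated tiling is $\mathcal{T}'=((t,u+1),\ \Gamma(\mathcal{O}\setminus C)\cup\mathcal{O}',\ \{\Gamma(\mathcal{R}_1),\ldots,\Gamma(\mathcal{R}_k)\})$. -}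

module Defs where

open import Level using (0ℓ)
open import Data.Nat as ℕ using (ℕ; zero; suc; _<_; _≤_)
open import Data.Nat.Properties using (<-cmp)
open import Data.Fin as Fin using (Fin) renaming (_<_ to _<ᶠ_)
open import Data.Vec using (Vec; []; _∷_; lookup; map)
open import Data.Product using (Σ; ∃; ∃-syntax; _×_; _,_; proj₁; proj₂)
open import Data.Sum using (_⊎_)
open import Data.Unit using (⊤)
open import Data.Bool using (if_then_else_)
open import Data.List using (List; []; _∷_)
open import Data.List.Relation.Unary.Any using (any?)
open import Data.List.Membership.Propositional using (_∈_; _∉_)
open import Relation.Nullary using (¬_; does)
open import Relation.Binary using (Setoid; Tri; tri<; tri≈; tri>)
open import Relation.Binary.PropositionalEquality
  using (_≡_; refl; sym; trans)

-- A cell (x , y) ∈ ℕ²  (x = column, y = row).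
Cell : Set
Cell = ℕ × ℕ

col row : Cell → ℕ
col = proj₁
row = proj₂

-- Raw data of a gridded permutation of size n: the permutation
-- π : {0,…,n-1} → {0,…,n-1} (0-indexed, given as the vector
-- π(0) … π(n-1)) and the cells c_0 … c_{n-1}.
record GP : Set where
  constructor gp
  field
    size  : ℕ
    perm  : Vec (Fin size) size
    cells : Vec Cell size
open GP public

π⟨_⟩ : (g : GP) → Fin (size g) → Fin (size g)
π⟨ g ⟩ i = lookup (perm g) i

c⟨_⟩ : (g : GP) → Fin (size g) → Cell
c⟨ g ⟩ i = lookup (cells g) i

IsPerm : GP → Set
IsPerm g = ∀ i j → π⟨ g ⟩ i ≡ π⟨ g ⟩ j → i ≡ j

Consistent : GP → Set
Consistent g =
  (∀ i j → i <ᶠ j → col (c⟨ g ⟩ i) ≤ col (c⟨ g ⟩ j)) ×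
  (∀ i j → π⟨ g ⟩ i <ᶠ π⟨ g ⟩ j → row (c⟨ g ⟩ i) ≤ row (c⟨ g ⟩ j))

Valid : GP → Set
Valid g = IsPerm g × Consistent g

InBox : ℕ → ℕ → GP → Set
InBox t u g = ∀ i → col (c⟨ g ⟩ i) < t × row (c⟨ g ⟩ i) < u

InG : ℕ → ℕ → GP → Set
InG t u g = Valid g × InBox t u g

record _≼_ (h g : GP) : Set where
  field
    emb    : Fin (size h) → Fin (size g)
    incr   : ∀ a b → a <ᶠ b → emb a <ᶠ emb b
    iso    : ∀ a b → (π⟨ h ⟩ a <ᶠ π⟨ h ⟩ b → π⟨ g ⟩ (emb a) <ᶠ π⟨ g ⟩ (emb b))
                   × (π⟨ g ⟩ (emb a) <ᶠ π⟨ g ⟩ (emb b) → π⟨ h ⟩ a <ᶠ π⟨ h ⟩ b)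
    cellEq : ∀ a → c⟨ g ⟩ (emb a) ≡ c⟨ h ⟩ a

point : Cell → GP
point c = gp 1 (Fin.zero ∷ []) (c ∷ [])

pat12 pat21 : Cell → Cell → GP
pat12 c d = gp 2 (Fin.zero ∷ Fin.suc Fin.zero ∷ []) (c ∷ d ∷ [])
pat21 c d = gp 2 (Fin.suc Fin.zero ∷ Fin.zero ∷ []) (c ∷ d ∷ [])

record Tiling : Set₁ where
  constructor tiling
  field
    width  : ℕ
    height : ℕ
    obs    : GP → Set
    reqs   : List (GP → Set)
open Tiling public

listTiling : ℕ → ℕ → List GP → List (List GP) → Tiling
listTiling t u O Rs = tiling t u (_∈ O) (mapReq Rs)
  where
  mapReq : List (List GP) → List (GP → Set)
  mapReq []       = []
  mapReq (R ∷ Rs) = (_∈ R) ∷ mapReq Rs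

ContainsReqs : List (GP → Set) → GP → Set
ContainsReqs []       g = ⊤
ContainsReqs (R ∷ Rs) g = (∃[ h ] (R h × h ≼ g)) × ContainsReqs Rs g

InGrid : Tiling → GP → Set
InGrid T g =
  InG (width T) (height T) g ×
  (∀ o → obs T o → ¬ (o ≼ g)) ×
  ContainsReqs (reqs T) g

GridSetoid : Tiling → ℕ → Setoid 0ℓ 0ℓ
GridSetoid T n = record
  { Carrier       = Σ GP (λ g → size g ≡ n × InGrid T g)
  ; _≈_           = λ a b → proj₁ a ≡ proj₁ b
  ; isEquivalence = record { refl = refl ; sym = sym ; trans = trans }
  }

EmptyCell : Tiling → Cell → Set
EmptyCell T c = obs T (point c)

NonemptyCell : Tiling → Cell → Set
NonemptyCell T c = ¬ EmptyCell T c

RowSubset : Tiling → ℕ → List Cell → Set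
RowSubset T r S =
  (¬ S ≡ []) ×
  (∀ c → c ∈ S → row c ≡ r × col c < width T × NonemptyCell T c)

InRowRest : Tiling → ℕ → List Cell → Cell → Set
InRowRest T r S c = row c ≡ r × col c < width T × NonemptyCell T c × c ∉ S

RowSepApplies : Tiling → ℕ → List Cell → Set
RowSepApplies T r S =
  ∀ c₁ c₂ → c₁ ∈ S → InRowRest T r S c₂ →
    (col c₁ < col c₂ → obs T (pat21 c₁ c₂)) ×
    (col c₂ < col c₁ → obs T (pat12 c₂ c₁))

RowCritical : Tiling → ℕ → List Cell → GP → Set
RowCritical T r S o =
  ∃[ c₁ ] ∃[ c₂ ] (c₁ ∈ S × InRowRest T r S c₂ ×
    ((col c₁ < col c₂ × o ≡ pat21 c₁ c₂) ⊎ (col c₂ < col c₁ × o ≡ pat12 c₂ c₁)))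

ColHasS : List Cell → ℕ → Set
ColHasS S i = Data.List.Relation.Unary.Any.Any (λ c → col c ≡ i) S

colHasS? : List Cell → ℕ → Data.Bool.Bool
colHasS? S i = does (any? (λ c → col c ℕ.≟ i) S)

γrow : ℕ → List Cell → Cell → Cell
γrow r S (i , j) with <-cmp j r
... | tri< _ _ _ = (i , j)
... | tri≈ _ _ _ = if colHasS? S i then (i , j) else (i , suc j)
... | tri> _ _ _ = (i , suc j)

Γrow : ℕ → List Cell → GP → GP
Γrow r S g = gp (size g) (perm g) (map (γrow r S) (cells g))

ΓrowSet : ℕ → List Cell → (GP → Set) → GP → Set
ΓrowSet r S X g' = ∃[ g ] (X g × Γrow r S g ≡ g' × Valid g')

RowNewObs : ℕ → ℕ → List Cell → GP → Set
RowNewObs t r S o =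
  (∃[ i ] (i < t × ¬ ColHasS S i × o ≡ point (i , r))) ⊎
  (∃[ i ] (ColHasS S i × o ≡ point (i , suc r)))

rowSeparate : Tiling → ℕ → List Cell → Tiling
rowSeparate T r S = tiling (width T) (suc (height T)) newObs (mapΓ (reqs T))
  where
  newObs : GP → Set
  newObs o = ΓrowSet r S (λ g → obs T g × ¬ RowCritical T r S g) o
           ⊎ RowNewObs (width T) r S o
  mapΓ : List (GP → Set) → List (GP → Set)
  mapΓ []       = []
  mapΓ (R ∷ Rs) = ΓrowSet r S R ∷ mapΓ Rs

ColSubset : Tiling → ℕ → List Cell → Set
ColSubset T c S =
  (¬ S ≡ []) ×
  (∀ d → d ∈ S → col d ≡ c × row d < height T × NonemptyCell T d)

InColRest : Tiling → ℕ → List Cell → Cell → Set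
InColRest T c S d = col d ≡ c × row d < height T × NonemptyCell T d × d ∉ S

-- Column separation applies to (c, S): every point of an S-cell must
-- lie to the left of every point of an S'-cell in column c.
ColSepApplies : Tiling → ℕ → List Cell → Set
ColSepApplies T c S =
  ∀ c₁ c₂ → c₁ ∈ S → InColRest T c S c₂ →
    (row c₁ < row c₂ → obs T (pat21 c₂ c₁)) ×
    (row c₂ < row c₁ → obs T (pat12 c₂ c₁))

ColCritical : Tiling → ℕ → List Cell → GP → Set
ColCritical T c S o =
  ∃[ c₁ ] ∃[ c₂ ] (c₁ ∈ S × InColRest T c S c₂ ×
    ((row c₁ < row c₂ × o ≡ pat21 c₂ c₁) ⊎ (row c₂ < row c₁ × o ≡ pat12 c₂ c₁)))

RowHasS : List Cell → ℕ → Set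
RowHasS S j = Data.List.Relation.Unary.Any.Any (λ d → row d ≡ j) S

rowHasS? : List Cell → ℕ → Data.Bool.Bool
rowHasS? S j = does (any? (λ d → row d ℕ.≟ j) S)

γcol : ℕ → List Cell → Cell → Cell
γcol c S (i , j) with <-cmp i c
... | tri< _ _ _ = (i , j)
... | tri≈ _ _ _ = if rowHasS? S j then (i , j) else (suc i , j)
... | tri> _ _ _ = (suc i , j)

Γcol : ℕ → List Cell → GP → GP
Γcol c S g = gp (size g) (perm g) (map (γcol c S) (cells g))

ΓcolSet : ℕ → List Cell → (GP → Set) → GP → Set
ΓcolSet c S X g' = ∃[ g ] (X g × Γcol c S g ≡ g' × Valid g')

ColNewObs : ℕ → ℕ → List Cell → GP → Set
ColNewObs u c S o =
  (∃[ j ] (j < u × ¬ RowHasS S j × o ≡ point (c , j))) ⊎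
  (∃[ j ] (RowHasS S j × o ≡ point (suc c , j)))

colSeparate : Tiling → ℕ → List Cell → Tiling
colSeparate T c S = tiling (suc (width T)) (height T) newObs (mapΓ (reqs T))
  where
  newObs : GP → Set
  newObs o = ΓcolSet c S (λ g → obs T g × ¬ ColCritical T c S g) o
           ⊎ ColNewObs (height T) c S o
  mapΓ : List (GP → Set) → List (GP → Set)
  mapΓ []       = []
  mapΓ (R ∷ Rs) = ΓcolSet c S R ∷ mapΓ Rs

WellFormed : ℕ → ℕ → List GP → List (List GP) → Set
WellFormed t u O Rs =
  (∀ o → o ∈ O → InG t u o) ×
  (∀ R h → R ∈ Rs → h ∈ R → InG t u h)

Incomparable : List GP → Set
Incomparable O = ∀ o o' → o ∈ O → o' ∈ O → o ≼ o' → o ≡ o'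

{-# OPTIONS --safe #-}
module Submission where

-- Row separation relabels cells by γ, which keeps the cells of S in row r and pushes the other
-- cells of row r, and all rows above, up by one; merging rows r and r+1 again is a left inverse.
-- Because row separation applies, in every element of Grid 𝒯 the points in cells of S lie below
-- the points in the remaining cells of row r, so γ keeps gridded permutations consistent. The new
-- point obstructions 𝒪′ cut out exactly the image of γ, relabelling preserves and reflects
-- containment, and the critical patterns become inconsistent under γ, so obstructions and
-- requirements correspond. Column separation is the same argument with rows and columns exchanged.

open import Defs
open import Data.Nat using (ℕ; _<_)
open import Data.Product using (_×_)
open import Data.List using (List)
open import Function.Bundles using (Inverse)

open import Data.Nat using (_≟_; suc; pred; _≤_; z≤n; s≤s)
open import Data.Nat.Properties
  using (<-cmp; ≤-refl; ≤-trans; ≤-<-trans; <-trans; <-irrefl; <-asym; <⇒≤; <⇒≱; <⇒≢;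
         ≤-<-connex; n≤1+n; n<1+n; m<n⇒m<1+n; <⇒≤pred; pred-mono-≤; ≤-pred; ≤-reflexive;
         suc-injective)
import Data.Fin as Fin
import Data.Fin.Properties as Finₚ
open import Data.Vec using (lookup; map; tabulate)
open import Data.Vec.Properties using (lookup-map; tabulate∘lookup; tabulate-cong)
open import Data.Bool using (Bool; true; false; if_then_else_)
open import Data.Bool.Properties using (¬-not)
open import Data.Product using (∃-syntax; _,_; proj₁; proj₂)
open import Data.Sum using (_⊎_; inj₁; inj₂)
open import Data.Unit using (tt)
open import Data.Empty using (⊥; ⊥-elim)
open import Data.List using ([]; _∷_)
open import Data.List.Relation.Unary.Any as Any using (Any; here; there; any?)
open import Data.List.Membership.Propositional using (_∈_; _∉_; find)
open import Relation.Nullary using (¬_; does; yes; no)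
open import Relation.Nullary.Decidable using (dec-true; dec-false)
open import Relation.Binary using (Setoid; tri<; tri≈; tri>)
open import Relation.Binary.PropositionalEquality
open import Data.List.Relation.Binary.Pointwise using (Pointwise; []; _∷_)

-- spread r b j is the new index of line j when a line is inserted just after line r;
-- line r itself is kept (b = true) or moved to the new line (b = false).
spread : ℕ → Bool → ℕ → ℕ
spread r b j with <-cmp j r
... | tri< _ _ _ = j
... | tri≈ _ _ _ = if b then j else suc j
... | tri> _ _ _ = suc j

merge : ℕ → ℕ → ℕ
merge r j with <-cmp j r
... | tri< _ _ _ = j
... | tri≈ _ _ _ = j
... | tri> _ _ _ = pred j

module _ {r : ℕ} {b : Bool} where

  spread-< : ∀ {j} → j < r → spread r b j ≡ j
  spread-< {j} j<r with <-cmp j r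
  ... | tri< _ _ _ = refl
  ... | tri≈ _ j≡r _ = ⊥-elim (<⇒≢ j<r j≡r)
  ... | tri> _ _ r<j = ⊥-elim (<-asym r<j j<r)

  spread-> : ∀ {j} → r < j → spread r b j ≡ suc j
  spread-> {j} r<j with <-cmp j r
  ... | tri< j<r _ _ = ⊥-elim (<-asym j<r r<j)
  ... | tri≈ _ j≡r _ = ⊥-elim (<⇒≢ r<j (sym j≡r))
  ... | tri> _ _ _ = refl

spread-≡ : ∀ r b → spread r b r ≡ (if b then r else suc r)
spread-≡ r b with <-cmp r r
... | tri< r<r _ _ = ⊥-elim (<-irrefl refl r<r)
... | tri≈ _ _ _ = refl
... | tri> _ _ r<r = ⊥-elim (<-irrefl refl r<r)

module _ {r : ℕ} where

  merge-≤ : ∀ {j} → j ≤ r → merge r j ≡ j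
  merge-≤ {j} j≤r with <-cmp j r
  ... | tri< _ _ _ = refl
  ... | tri≈ _ _ _ = refl
  ... | tri> _ _ r<j = ⊥-elim (<⇒≱ r<j j≤r)

  merge-> : ∀ {j} → r < j → merge r j ≡ pred j
  merge-> {j} r<j with <-cmp j r
  ... | tri< j<r _ _ = ⊥-elim (<-asym j<r r<j)
  ... | tri≈ _ j≡r _ = ⊥-elim (<⇒≢ r<j (sym j≡r))
  ... | tri> _ _ _ = refl

data Position (j r : ℕ) : Set where
  below : j < r → Position j r
  at    : j ≡ r → Position j r
  above : r < j → Position j r

position : ∀ j r → Position j r
position j r with <-cmp j r
... | tri< j<r _ _ = below j<r
... | tri≈ _ j≡r _ = at j≡r
... | tri> _ _ r<j = above r<j

merge-spread : ∀ r b j → merge r (spread r b j) ≡ j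
merge-spread r b j with position j r
merge-spread r b j     | below j<r = trans (cong (merge r) (spread-< j<r)) (merge-≤ (<⇒≤ j<r))
merge-spread r true j  | at refl = trans (cong (merge r) (spread-≡ r true)) (merge-≤ {r} ≤-refl)
merge-spread r false j | at refl = trans (cong (merge r) (spread-≡ r false)) (merge-> (n<1+n r))
merge-spread r b j     | above r<j = trans (cong (merge r) (spread-> r<j)) (merge-> (m<n⇒m<1+n r<j))

spread-merge : ∀ r b j → (j ≡ r → b ≡ true) → (j ≡ suc r → b ≡ false) →
               spread r b (merge r j) ≡ j
spread-merge r b j keep move with position j r
... | below j<r = trans (cong (spread r b) (merge-≤ (<⇒≤ j<r))) (spread-< j<r)
... | at refl = trans (cong (spread r b) (merge-≤ {r} ≤-refl))
                      (subst (λ b → spread r b r ≡ r) (sym (keep refl)) (spread-≡ r true))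
spread-merge r b (suc j) keep move | above (s≤s r≤j) with position j r
... | below j<r = ⊥-elim (<⇒≱ j<r r≤j)
... | at refl = trans (cong (spread r b) (merge-> (s≤s r≤j)))
                      (subst (λ b → spread r b r ≡ suc r) (sym (move refl)) (spread-≡ r false))
... | above r<j = trans (cong (spread r b) (merge-> (s≤s r≤j))) (spread-> r<j)

≤-spread : ∀ r b j → j ≤ spread r b j
≤-spread r b j with position j r
≤-spread r b j     | below j<r = ≤-reflexive (sym (spread-< j<r))
≤-spread r true j  | at refl = ≤-reflexive (sym (spread-≡ r true))
≤-spread r false j | at refl = subst (j ≤_) (sym (spread-≡ r false)) (n≤1+n j)
≤-spread r b j     | above r<j = subst (j ≤_) (sym (spread-> r<j)) (n≤1+n j)

spread-≤-suc : ∀ r b j → spread r b j ≤ suc j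
spread-≤-suc r b j with position j r
spread-≤-suc r b j     | below j<r = subst (_≤ suc j) (sym (spread-< j<r)) (n≤1+n j)
spread-≤-suc r true j  | at refl = subst (_≤ suc j) (sym (spread-≡ r true)) (n≤1+n j)
spread-≤-suc r false j | at refl = ≤-reflexive (spread-≡ r false)
spread-≤-suc r b j     | above r<j = ≤-reflexive (spread-> r<j)

spread-mono : ∀ r b b′ {j k} → j ≤ k →
              spread r b j ≤ spread r b′ k ⊎ (j ≡ r × k ≡ r × b ≡ false × b′ ≡ true)
spread-mono r b b′ {j} {k} j≤k with position j r | position k r
... | below j<r | _ = inj₁ (subst (_≤ spread r b′ k) (sym (spread-< j<r)) (≤-trans j≤k (≤-spread r b′ k)))
... | at refl | below k<r = ⊥-elim (<⇒≱ k<r j≤k)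
... | above r<j | below k<r = ⊥-elim (<⇒≱ (<-trans k<r r<j) j≤k)
... | above r<j | at refl = ⊥-elim (<⇒≱ r<j j≤k)
... | above r<j | above r<k = inj₁ (subst₂ _≤_ (sym (spread-> r<j)) (sym (spread-> r<k)) (s≤s j≤k))
... | at refl | above r<k = inj₁ (subst (spread r b j ≤_) (sym (spread-> r<k))
                                               (≤-trans (spread-≤-suc r b j) (s≤s (<⇒≤ r<k))))
spread-mono r true b′ _ | at refl | at refl =
  inj₁ (subst (_≤ spread r b′ r) (sym (spread-≡ r true)) (≤-spread r b′ r))
spread-mono r false false _ | at refl | at refl = inj₁ ≤-refl
spread-mono r false true _ | at refl | at refl = inj₂ (refl , refl , refl , refl)

merge-mono : ∀ r {j k} → j ≤ k → merge r j ≤ merge r k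
merge-mono r {j} {k} j≤k with ≤-<-connex j r | ≤-<-connex k r
... | inj₁ j≤r | inj₁ k≤r = subst₂ _≤_ (sym (merge-≤ j≤r)) (sym (merge-≤ k≤r)) j≤k
... | inj₁ j≤r | inj₂ r<k =
  subst₂ _≤_ (sym (merge-≤ j≤r)) (sym (merge-> r<k)) (≤-trans j≤r (<⇒≤pred r<k))
... | inj₂ r<j | inj₁ k≤r = ⊥-elim (<⇒≱ r<j (≤-trans j≤k k≤r))
... | inj₂ r<j | inj₂ r<k = subst₂ _≤_ (sym (merge-> r<j)) (sym (merge-> r<k)) (pred-mono-≤ j≤k)

merge-< : ∀ {r u j} → r < u → j < suc u → merge r j < u
merge-< {r} {u} {j} r<u j<1+u with ≤-<-connex j r
... | inj₁ j≤r = subst (_< u) (sym (merge-≤ j≤r)) (≤-<-trans j≤r r<u)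
... | inj₂ r<j@(s≤s _) = subst (_< u) (sym (merge-> r<j)) (≤-pred j<1+u)

spread≡r⇒kept : ∀ r b j → spread r b j ≡ r → b ≡ true
spread≡r⇒kept r b j eq with position j r
spread≡r⇒kept r b j     eq | below j<r = ⊥-elim (<⇒≢ j<r (trans (sym (spread-< j<r)) eq))
spread≡r⇒kept r b j     eq | above r<j = ⊥-elim (<⇒≢ (m<n⇒m<1+n r<j) (sym (trans (sym (spread-> r<j)) eq)))
spread≡r⇒kept r true j  eq | at _ = refl
spread≡r⇒kept r false j eq | at refl = ⊥-elim (<⇒≢ (n<1+n j) (sym (trans (sym (spread-≡ r false)) eq)))

spread≡1+r⇒moved : ∀ r b j → spread r b j ≡ suc r → b ≡ false
spread≡1+r⇒moved r b j eq with position j r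
spread≡1+r⇒moved r b j     eq | below j<r = ⊥-elim (<⇒≢ (m<n⇒m<1+n j<r) (trans (sym (spread-< j<r)) eq))
spread≡1+r⇒moved r b j     eq | above r<j = ⊥-elim (<⇒≢ r<j (sym (suc-injective (trans (sym (spread-> r<j)) eq))))
spread≡1+r⇒moved r false j eq | at _ = refl
spread≡1+r⇒moved r true j  eq | at refl = ⊥-elim (<⇒≢ (n<1+n j) (trans (sym (spread-≡ r true)) eq))

relabel : (Cell → Cell) → GP → GP
relabel f g = gp (size g) (perm g) (map f (cells g))

lookup-relabel : ∀ f g i → c⟨ relabel f g ⟩ i ≡ f (c⟨ g ⟩ i)
lookup-relabel f g i = lookup-map i f (cells g)

relabel-≼ : ∀ f {h g} → h ≼ g → relabel f h ≼ relabel f g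
relabel-≼ f {h} {g} h≼g = record
  { emb = emb ; incr = incr ; iso = iso
  ; cellEq = λ a → begin
      c⟨ relabel f g ⟩ (emb a) ≡⟨ lookup-relabel f g (emb a) ⟩
      f (c⟨ g ⟩ (emb a))       ≡⟨ cong f (cellEq a) ⟩
      f (c⟨ h ⟩ a)             ≡⟨ lookup-relabel f h a ⟨
      c⟨ relabel f h ⟩ a       ∎ }
  where open _≼_ h≼g; open ≡-Reasoning

≼-unrelabel : ∀ f δ → (∀ c → δ (f c) ≡ c) → ∀ {h g} → relabel f h ≼ relabel f g → h ≼ g
≼-unrelabel f δ δ∘f≗id {h} {g} fh≼fg = record
  { emb = emb ; incr = incr ; iso = iso
  ; cellEq = λ a → begin
      c⟨ g ⟩ (emb a)                 ≡⟨ δ∘f≗id _ ⟨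
      δ (f (c⟨ g ⟩ (emb a)))         ≡⟨ cong δ (lookup-relabel f g (emb a)) ⟨
      δ (c⟨ relabel f g ⟩ (emb a))   ≡⟨ cong δ (cellEq a) ⟩
      δ (c⟨ relabel f h ⟩ a)         ≡⟨ cong δ (lookup-relabel f h a) ⟩
      δ (f (c⟨ h ⟩ a))               ≡⟨ δ∘f≗id _ ⟩
      c⟨ h ⟩ a                       ∎ }
  where open _≼_ fh≼fg; open ≡-Reasoning

valid-≼ : ∀ {h g} → h ≼ g → Valid g → IsPerm h → Valid h
valid-≼ {h} {g} h≼g (_ , colsOrdered , rowsOrdered) π-inj = π-inj , colsOrdered′ , rowsOrdered′
  where
  open _≼_ h≼g
  colsOrdered′ : ∀ i j → i Fin.< j → col (c⟨ h ⟩ i) ≤ col (c⟨ h ⟩ j)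
  colsOrdered′ i j i<j =
    subst₂ _≤_ (cong col (cellEq i)) (cong col (cellEq j)) (colsOrdered _ _ (incr i j i<j))
  rowsOrdered′ : ∀ i j → π⟨ h ⟩ i Fin.< π⟨ h ⟩ j → row (c⟨ h ⟩ i) ≤ row (c⟨ h ⟩ j)
  rowsOrdered′ i j πi<πj =
    subst₂ _≤_ (cong row (cellEq i)) (cong row (cellEq j)) (rowsOrdered _ _ (proj₁ (iso i j) πi<πj))

relabel-relabel : ∀ f δ g → (∀ i → δ (f (c⟨ g ⟩ i)) ≡ c⟨ g ⟩ i) → relabel δ (relabel f g) ≡ g
relabel-relabel f δ g δ∘f≗id = cong (gp (size g) (perm g)) (begin
  map δ (map f (cells g))                      ≡⟨ tabulate∘lookup _ ⟨
  tabulate (lookup (map δ (map f (cells g))))  ≡⟨ tabulate-cong lookup≗ ⟩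
  tabulate (lookup (cells g))                  ≡⟨ tabulate∘lookup (cells g) ⟩
  cells g                                      ∎)
  where
  open ≡-Reasoning
  lookup≗ : ∀ i → lookup (map δ (map f (cells g))) i ≡ lookup (cells g) i
  lookup≗ i = trans (lookup-relabel δ (relabel f g) i) (trans (cong δ (lookup-relabel f g i)) (δ∘f≗id i))

point-≼ : ∀ g i → point (c⟨ g ⟩ i) ≼ g
point-≼ g i = record
  { emb = λ _ → i
  ; incr = λ { Fin.zero Fin.zero () }
  ; iso = λ { Fin.zero Fin.zero → (λ ()) , (λ i<i → ⊥-elim (Finₚ.<-irrefl refl i<i)) }
  ; cellEq = λ { Fin.zero → refl } }

pat12-≼ : ∀ g a b → a Fin.< b → π⟨ g ⟩ a Fin.< π⟨ g ⟩ b → pat12 (c⟨ g ⟩ a) (c⟨ g ⟩ b) ≼ g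
pat12-≼ g a b a<b πa<πb = record
  { emb = λ { Fin.zero → a ; (Fin.suc Fin.zero) → b }
  ; incr = λ { Fin.zero (Fin.suc Fin.zero) _ → a<b
             ; Fin.zero Fin.zero () ; (Fin.suc Fin.zero) (Fin.suc Fin.zero) (s≤s ())
             ; (Fin.suc Fin.zero) Fin.zero () }
  ; iso = λ { Fin.zero Fin.zero → (λ ()) , (λ lt → ⊥-elim (Finₚ.<-irrefl refl lt))
            ; Fin.zero (Fin.suc Fin.zero) → (λ _ → πa<πb) , (λ _ → s≤s z≤n)
            ; (Fin.suc Fin.zero) Fin.zero → (λ ()) , (λ lt → ⊥-elim (Finₚ.<-asym πa<πb lt))
            ; (Fin.suc Fin.zero) (Fin.suc Fin.zero) → (λ { (s≤s ()) }) , (λ lt → ⊥-elim (Finₚ.<-irrefl refl lt)) }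
  ; cellEq = λ { Fin.zero → refl ; (Fin.suc Fin.zero) → refl } }

pat21-≼ : ∀ g a b → a Fin.< b → π⟨ g ⟩ b Fin.< π⟨ g ⟩ a → pat21 (c⟨ g ⟩ a) (c⟨ g ⟩ b) ≼ g
pat21-≼ g a b a<b πb<πa = record
  { emb = λ { Fin.zero → a ; (Fin.suc Fin.zero) → b }
  ; incr = λ { Fin.zero (Fin.suc Fin.zero) _ → a<b
             ; Fin.zero Fin.zero () ; (Fin.suc Fin.zero) (Fin.suc Fin.zero) (s≤s ())
             ; (Fin.suc Fin.zero) Fin.zero () }
  ; iso = λ { Fin.zero Fin.zero → (λ { (s≤s ()) }) , (λ lt → ⊥-elim (Finₚ.<-irrefl refl lt))
            ; Fin.zero (Fin.suc Fin.zero) → (λ ()) , (λ lt → ⊥-elim (Finₚ.<-asym πb<πa lt))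
            ; (Fin.suc Fin.zero) Fin.zero → (λ _ → πb<πa) , (λ _ → s≤s z≤n)
            ; (Fin.suc Fin.zero) (Fin.suc Fin.zero) → (λ ()) , (λ lt → ⊥-elim (Finₚ.<-irrefl refl lt)) }
  ; cellEq = λ { Fin.zero → refl ; (Fin.suc Fin.zero) → refl } }

Avoids : (GP → Set) → GP → Set
Avoids X g = ∀ o → X o → ¬ o ≼ g

record IsRelabelImage (f : Cell → Cell) (R R′ : GP → Set) : Set where
  field
    preimage : ∀ h′ → R′ h′ → ∃[ h ] (R h × relabel f h ≡ h′)
    image    : ∀ h → R h → Valid (relabel f h) → R′ (relabel f h)
    isPerm   : ∀ h → R h → IsPerm h

module _ {f : Cell → Cell} where

  containsReqs-relabel : ∀ {Rs Rs′} → Pointwise (IsRelabelImage f) Rs Rs′ →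
                         ∀ g → Valid (relabel f g) → ContainsReqs Rs g → ContainsReqs Rs′ (relabel f g)
  containsReqs-relabel []                g _     _                        = tt
  containsReqs-relabel (R∼R′ ∷ Rs∼Rs′) g valid ((h , Rh , h≼g) , reqs) =
    ( relabel f h
    , image h Rh (valid-≼ (relabel-≼ f h≼g) valid (isPerm h Rh))
    , relabel-≼ f h≼g )
    , containsReqs-relabel Rs∼Rs′ g valid reqs
    where open IsRelabelImage R∼R′

  containsReqs-unrelabel : ∀ δ → (∀ c → δ (f c) ≡ c) →
                           ∀ {Rs Rs′} → Pointwise (IsRelabelImage f) Rs Rs′ →
                           ∀ g → ContainsReqs Rs′ (relabel f g) → ContainsReqs Rs g
  containsReqs-unrelabel δ δ∘f≗id []                g _ = tt
  containsReqs-unrelabel δ δ∘f≗id (R∼R′ ∷ Rs∼Rs′) g ((h′ , R′h′ , h′≼) , reqs)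
    with IsRelabelImage.preimage R∼R′ h′ R′h′
  ... | h , Rh , refl =
    (h , Rh , ≼-unrelabel f δ δ∘f≗id h′≼) , containsReqs-unrelabel δ δ∘f≗id Rs∼Rs′ g reqs

-- Critical obstructions need no counterpart in T′: a critical o has an inconsistent f-image,
-- so it is never contained in the preimage δ g′ of a consistent g′.
module RelabellingInverse
  (T T′ : Tiling) (f δ : Cell → Cell) (δ∘f≗id : ∀ c → δ (f c) ≡ c)
  (Critical New : GP → Set)
  (obs′-cases       : ∀ o → obs T′ o → (∃[ o₀ ] (obs T o₀ × relabel f o₀ ≡ o)) ⊎ New o)
  (obs-relabel      : ∀ o → obs T o → ¬ Critical o → Valid (relabel f o) → obs T′ (relabel f o))
  (new⇒obs′         : ∀ o → New o → obs T′ o)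
  (obs-isPerm       : ∀ o → obs T o → IsPerm o)
  (critical-invalid : ∀ o → Critical o → ¬ Valid (relabel f o))
  (reqs-image       : Pointwise (IsRelabelImage f) (reqs T) (reqs T′))
  (forward  : ∀ g → InG (width T) (height T) g → Avoids (obs T) g →
              InG (width T′) (height T′) (relabel f g) × Avoids New (relabel f g))
  (backward : ∀ g′ → InG (width T′) (height T′) g′ → Avoids New g′ →
              InG (width T) (height T) (relabel δ g′) × relabel f (relabel δ g′) ≡ g′)
  (n : ℕ)
  where

  to : Setoid.Carrier (GridSetoid T n) → Setoid.Carrier (GridSetoid T′ n)
  to (g , size≡n , inG , avoids , reqs) =
    relabel f g , size≡n , inG′ , avoids′ , containsReqs-relabel reqs-image g (proj₁ inG′) reqs
    where
    inG′ = proj₁ (forward g inG avoids)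
    avoids′ : Avoids (obs T′) (relabel f g)
    avoids′ o o∈obs′ o≼fg with obs′-cases o o∈obs′
    ... | inj₁ (o₀ , o₀∈obs , refl) = avoids o₀ o₀∈obs (≼-unrelabel f δ δ∘f≗id o≼fg)
    ... | inj₂ new = proj₂ (forward g inG avoids) o new o≼fg

  backward′ : (x : Setoid.Carrier (GridSetoid T′ n)) →
              InG (width T) (height T) (relabel δ (proj₁ x)) × relabel f (relabel δ (proj₁ x)) ≡ proj₁ x
  backward′ (g′ , _ , inG′ , avoids′ , _) = backward g′ inG′ (λ o new → avoids′ o (new⇒obs′ o new))

  from : Setoid.Carrier (GridSetoid T′ n) → Setoid.Carrier (GridSetoid T n)
  from x@(g′ , size≡n , inG′ , avoids′ , reqs′) =
    relabel δ g′ , size≡n , inG , avoids ,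
    containsReqs-unrelabel δ δ∘f≗id reqs-image (relabel δ g′)
      (subst (ContainsReqs (reqs T′)) (sym f∘δg′≡g′) reqs′)
    where
    inG = proj₁ (backward′ x)
    f∘δg′≡g′ = proj₂ (backward′ x)
    avoids : Avoids (obs T) (relabel δ g′)
    avoids o o∈obs o≼δg′ =
      avoids′ (relabel f o) (obs-relabel o o∈obs (λ crit → critical-invalid o crit valid) valid) fo≼g′
      where
      fo≼g′ : relabel f o ≼ g′
      fo≼g′ = subst (relabel f o ≼_) f∘δg′≡g′ (relabel-≼ f o≼δg′)
      valid : Valid (relabel f o)
      valid = valid-≼ fo≼g′ (proj₁ inG′) (obs-isPerm o o∈obs)

  inverse : Inverse (GridSetoid T n) (GridSetoid T′ n)
  inverse = record
    { to = to ; from = from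
    ; to-cong = cong (relabel f)
    ; from-cong = cong (relabel δ)
    ; inverse = (λ {x} y≡from-x → trans (cong (relabel f) y≡from-x) (proj₂ (backward′ x)))
              , (λ {x} y≡to-x →
                   trans (cong (relabel δ) y≡to-x) (relabel-relabel f δ (proj₁ x) (λ _ → δ∘f≗id _)))
    }

module LineMembership (p : Cell → ℕ) (S : List Cell) where

  occupied : ℕ → Bool
  occupied i = does (any? (λ c → p c ≟ i) S)

  occupied-true : ∀ {i} → Any (λ c → p c ≡ i) S → occupied i ≡ true
  occupied-true = dec-true (any? _ S)

  occupied-false : ∀ {i} → ¬ Any (λ c → p c ≡ i) S → occupied i ≡ false
  occupied-false = dec-false (any? _ S)

  true⇒occupied : ∀ {i} → occupied i ≡ true → Any (λ c → p c ≡ i) S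
  true⇒occupied {i} e with any? (λ c → p c ≟ i) S
  ... | yes a = a
  ... | no _ with () ← e

  false⇒unoccupied : ∀ {i} → occupied i ≡ false → ¬ Any (λ c → p c ≡ i) S
  false⇒unoccupied e a with () ← trans (sym (occupied-true a)) e

  ∈⇒occupied : ∀ {c} → c ∈ S → occupied (p c) ≡ true
  ∈⇒occupied c∈S = occupied-true (Any.map (λ c≡s → cong p (sym c≡s)) c∈S)

γrow-spread : ∀ r S i j → γrow r S (i , j) ≡ (i , spread r (colHasS? S i) j)
γrow-spread r S i j with <-cmp j r
... | tri< _ _ _ = refl
... | tri≈ _ _ _ with colHasS? S i
...   | true  = refl
...   | false = refl
γrow-spread r S i j | tri> _ _ _ = refl

module RowSeparation (t u : ℕ) (O : List GP) (Rs : List (List GP)) (r : ℕ) (S : List Cell)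
  (wf : WellFormed t u O Rs) (r<u : r < u)
  (S⊆row : RowSubset (listTiling t u O Rs) r S)
  (separated : RowSepApplies (listTiling t u O Rs) r S) where

  open LineMembership col S

  𝒯 𝒯′ : Tiling
  𝒯  = listTiling t u O Rs
  𝒯′ = rowSeparate 𝒯 r S

  f δ : Cell → Cell
  f = γrow r S
  δ (i , j) = (i , merge r j)

  col-f : ∀ c → col (f c) ≡ col c
  col-f (i , j) = cong col (γrow-spread r S i j)

  row-f : ∀ c → row (f c) ≡ spread r (occupied (col c)) (row c)
  row-f (i , j) = cong row (γrow-spread r S i j)

  δ∘f≗id : ∀ c → δ (f c) ≡ c
  δ∘f≗id (i , j) = trans (cong δ (γrow-spread r S i j)) (cong (i ,_) (merge-spread r _ j))

  occupied⇒∈S : ∀ d → row d ≡ r → occupied (col d) ≡ true → d ∈ S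
  occupied⇒∈S d rd≡r occ with find (true⇒occupied occ)
  ... | s , s∈S , cs≡cd =
    subst (_∈ S) (cong₂ _,_ cs≡cd (trans (proj₁ (proj₂ S⊆row s s∈S)) (sym rd≡r))) s∈S

  rest⇒unoccupied : ∀ c → row c ≡ r → c ∉ S → occupied (col c) ≡ false
  rest⇒unoccupied c rc≡r c∉S = occupied-false (λ a → c∉S (occupied⇒∈S c rc≡r (occupied-true a)))

  ∈S⇒row-f : ∀ c → c ∈ S → row (f c) ≡ r
  ∈S⇒row-f c c∈S = begin
    row (f c)                                ≡⟨ row-f c ⟩
    spread r (occupied (col c)) (row c)      ≡⟨ cong₂ (spread r) (∈⇒occupied c∈S) (proj₁ (proj₂ S⊆row c c∈S)) ⟩
    spread r true r                          ≡⟨ spread-≡ r true ⟩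
    r                                        ∎
    where open ≡-Reasoning

  rest⇒row-f : ∀ c → InRowRest 𝒯 r S c → row (f c) ≡ suc r
  rest⇒row-f c (rc≡r , _ , _ , c∉S) = begin
    row (f c)                                ≡⟨ row-f c ⟩
    spread r (occupied (col c)) (row c)      ≡⟨ cong₂ (spread r) (rest⇒unoccupied c rc≡r c∉S) rc≡r ⟩
    spread r false r                         ≡⟨ spread-≡ r false ⟩
    suc r                                    ∎
    where open ≡-Reasoning

  critical-invalid : ∀ o → RowCritical 𝒯 r S o → ¬ Valid (relabel f o)
  critical-invalid _ (c₁ , c₂ , c₁∈S , rest , inj₁ (_ , refl)) (_ , _ , rowsOrdered) =
    <-irrefl refl (subst₂ _≤_ (rest⇒row-f c₂ rest) (∈S⇒row-f c₁ c₁∈S)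
                              (rowsOrdered (Fin.suc Fin.zero) Fin.zero (s≤s z≤n)))
  critical-invalid _ (c₁ , c₂ , c₁∈S , rest , inj₂ (_ , refl)) (_ , _ , rowsOrdered) =
    <-irrefl refl (subst₂ _≤_ (rest⇒row-f c₂ rest) (∈S⇒row-f c₁ c₁∈S)
                              (rowsOrdered Fin.zero (Fin.suc Fin.zero) (s≤s z≤n)))

  ¬rest-below-S : ∀ g → InG t u g → Avoids (obs 𝒯) g →
                  ∀ i j → π⟨ g ⟩ i Fin.< π⟨ g ⟩ j → row (c⟨ g ⟩ i) ≡ r → row (c⟨ g ⟩ j) ≡ r →
                  occupied (col (c⟨ g ⟩ i)) ≡ false → occupied (col (c⟨ g ⟩ j)) ≡ true → ⊥
  ¬rest-below-S g ((π-inj , colsOrdered , _) , box) avoids i j πi<πj ri≡r rj≡r unocc occ =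
    compareCols (position (col d) (col c))
    where
    c d : Cell
    c = c⟨ g ⟩ i
    d = c⟨ g ⟩ j
    d∈S : d ∈ S
    d∈S = occupied⇒∈S d rj≡r occ
    c∉S : c ∉ S
    c∉S c∈S = false⇒unoccupied unocc (Any.map (λ c≡s → cong col (sym c≡s)) c∈S)
    rest : InRowRest 𝒯 r S c
    rest = ri≡r , proj₁ (box i) , (λ empty → avoids (point c) empty (point-≼ g i)) , c∉S
    compareCols : Position (col d) (col c) → ⊥
    compareCols (below cd<cc) with Finₚ.<-cmp i j
    ... | tri< i<j _ _ = <⇒≱ cd<cc (colsOrdered i j i<j)
    ... | tri≈ _ refl _ = Finₚ.<-irrefl refl πi<πj
    ... | tri> _ _ j<i = avoids (pat21 d c) (proj₁ (separated d c d∈S rest) cd<cc) (pat21-≼ g j i j<i πi<πj)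
    compareCols (at cd≡cc) = c∉S (subst (_∈ S) (cong₂ _,_ cd≡cc (trans rj≡r (sym ri≡r))) d∈S)
    compareCols (above cc<cd) with Finₚ.<-cmp i j
    ... | tri< i<j _ _ = avoids (pat12 c d) (proj₂ (separated d c d∈S rest) cc<cd) (pat12-≼ g i j i<j πi<πj)
    ... | tri≈ _ refl _ = Finₚ.<-irrefl refl πi<πj
    ... | tri> _ _ j<i = <⇒≱ cc<cd (colsOrdered j i j<i)

  relabel-avoids-new : ∀ g → Avoids (RowNewObs t r S) (relabel f g)
  relabel-avoids-new g o (inj₁ (i , _ , unocc , refl)) o≼fg =
    unocc (subst (λ i → Any (λ c → col c ≡ i) S) col≡i (true⇒occupied occ))
    where
    open _≼_ o≼fg
    e = emb Fin.zero
    fc≡ : f (c⟨ g ⟩ e) ≡ (i , r)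
    fc≡ = trans (sym (lookup-relabel f g e)) (cellEq Fin.zero)
    col≡i : col (c⟨ g ⟩ e) ≡ i
    col≡i = trans (sym (col-f (c⟨ g ⟩ e))) (cong col fc≡)
    occ : occupied (col (c⟨ g ⟩ e)) ≡ true
    occ = spread≡r⇒kept r _ (row (c⟨ g ⟩ e)) (trans (sym (row-f (c⟨ g ⟩ e))) (cong row fc≡))
  relabel-avoids-new g o (inj₂ (i , occ , refl)) o≼fg =
    false⇒unoccupied (subst (λ i → occupied i ≡ false) col≡i unocc) occ
    where
    open _≼_ o≼fg
    e = emb Fin.zero
    fc≡ : f (c⟨ g ⟩ e) ≡ (i , suc r)
    fc≡ = trans (sym (lookup-relabel f g e)) (cellEq Fin.zero)
    col≡i : col (c⟨ g ⟩ e) ≡ i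
    col≡i = trans (sym (col-f (c⟨ g ⟩ e))) (cong col fc≡)
    unocc : occupied (col (c⟨ g ⟩ e)) ≡ false
    unocc = spread≡1+r⇒moved r _ (row (c⟨ g ⟩ e)) (trans (sym (row-f (c⟨ g ⟩ e))) (cong row fc≡))

  relabel-InG : ∀ g → InG t u g → Avoids (obs 𝒯) g → InG t (suc u) (relabel f g)
  relabel-InG g inG@((π-inj , colsOrdered , rowsOrdered) , box) avoids =
    (π-inj , colsOrdered′ , rowsOrdered′) , box′
    where
    col≡ : ∀ i → col (c⟨ relabel f g ⟩ i) ≡ col (c⟨ g ⟩ i)
    col≡ i = trans (cong col (lookup-relabel f g i)) (col-f (c⟨ g ⟩ i))
    row≡ : ∀ i → row (c⟨ relabel f g ⟩ i) ≡ spread r (occupied (col (c⟨ g ⟩ i))) (row (c⟨ g ⟩ i))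
    row≡ i = trans (cong row (lookup-relabel f g i)) (row-f (c⟨ g ⟩ i))
    colsOrdered′ : ∀ i j → i Fin.< j → col (c⟨ relabel f g ⟩ i) ≤ col (c⟨ relabel f g ⟩ j)
    colsOrdered′ i j i<j = subst₂ _≤_ (sym (col≡ i)) (sym (col≡ j)) (colsOrdered i j i<j)
    rowsOrdered′ : ∀ i j → π⟨ g ⟩ i Fin.< π⟨ g ⟩ j → row (c⟨ relabel f g ⟩ i) ≤ row (c⟨ relabel f g ⟩ j)
    rowsOrdered′ i j πi<πj with spread-mono r _ _ (rowsOrdered i j πi<πj)
    ... | inj₁ ≤′ = subst₂ _≤_ (sym (row≡ i)) (sym (row≡ j)) ≤′
    ... | inj₂ (ri≡r , rj≡r , unocc , occ) = ⊥-elim (¬rest-below-S g inG avoids i j πi<πj ri≡r rj≡r unocc occ)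
    box′ : InBox t (suc u) (relabel f g)
    box′ i = subst (_< t) (sym (col≡ i)) (proj₁ (box i))
           , subst (_< suc u) (sym (row≡ i)) (≤-<-trans (spread-≤-suc r _ _) (s≤s (proj₂ (box i))))

  relabel-unrelabel : ∀ g′ → InBox t (suc u) g′ → Avoids (RowNewObs t r S) g′ →
                      ∀ e → f (δ (c⟨ g′ ⟩ e)) ≡ c⟨ g′ ⟩ e
  relabel-unrelabel g′ box avoids e =
    trans (γrow-spread r S i (merge r j)) (cong (i ,_) (spread-merge r (occupied i) j kept moved))
    where
    i = col (c⟨ g′ ⟩ e)
    j = row (c⟨ g′ ⟩ e)
    point-at : ∀ {k} → j ≡ k → point (i , k) ≼ g′
    point-at refl = point-≼ g′ e
    kept : j ≡ r → occupied i ≡ true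
    kept j≡r = ¬-not λ unocc →
      avoids (point (i , r)) (inj₁ (i , proj₁ (box e) , false⇒unoccupied unocc , refl)) (point-at j≡r)
    moved : j ≡ suc r → occupied i ≡ false
    moved j≡1+r = ¬-not λ occ →
      avoids (point (i , suc r)) (inj₂ (i , true⇒occupied occ , refl)) (point-at j≡1+r)

  unrelabel-InG : ∀ g′ → InG t (suc u) g′ → InG t u (relabel δ g′)
  unrelabel-InG g′ ((π-inj , colsOrdered , rowsOrdered) , box) = (π-inj , colsOrdered′ , rowsOrdered′) , box′
    where
    δ≡ : ∀ i → c⟨ relabel δ g′ ⟩ i ≡ δ (c⟨ g′ ⟩ i)
    δ≡ i = lookup-relabel δ g′ i
    colsOrdered′ : ∀ i j → i Fin.< j → col (c⟨ relabel δ g′ ⟩ i) ≤ col (c⟨ relabel δ g′ ⟩ j)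
    colsOrdered′ i j i<j = subst₂ _≤_ (sym (cong col (δ≡ i))) (sym (cong col (δ≡ j))) (colsOrdered i j i<j)
    rowsOrdered′ : ∀ i j → π⟨ g′ ⟩ i Fin.< π⟨ g′ ⟩ j → row (c⟨ relabel δ g′ ⟩ i) ≤ row (c⟨ relabel δ g′ ⟩ j)
    rowsOrdered′ i j πi<πj =
      subst₂ _≤_ (sym (cong row (δ≡ i))) (sym (cong row (δ≡ j))) (merge-mono r (rowsOrdered i j πi<πj))
    box′ : InBox t u (relabel δ g′)
    box′ i = subst (_< t) (sym (cong col (δ≡ i))) (proj₁ (box i))
           , subst (_< u) (sym (cong row (δ≡ i))) (merge-< r<u (proj₂ (box i)))

  requirements-image : ∀ Rs′ → (∀ R h → R ∈ Rs′ → h ∈ R → InG t u h) →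
    Pointwise (IsRelabelImage f) (reqs (listTiling t u O Rs′)) (reqs (rowSeparate (listTiling t u O Rs′) r S))
  requirements-image []        _      = []
  requirements-image (R ∷ Rs′) inG-Rs = record
    { preimage = λ { _ (h , h∈R , refl , _) → h , h∈R , refl }
    ; image    = λ h h∈R valid → h , h∈R , refl , valid
    ; isPerm   = λ h h∈R → proj₁ (proj₁ (inG-Rs R h (here refl) h∈R))
    } ∷ requirements-image Rs′ (λ R′ h R′∈Rs′ → inG-Rs R′ h (there R′∈Rs′))

  inverse : ∀ n → Inverse (GridSetoid 𝒯 n) (GridSetoid 𝒯′ n)
  inverse = RelabellingInverse.inverse 𝒯 𝒯′ f δ δ∘f≗id (RowCritical 𝒯 r S) (RowNewObs t r S)
    (λ { _ (inj₁ (o₀ , (o₀∈O , _) , fo₀≡o , _)) → inj₁ (o₀ , o₀∈O , fo₀≡o)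
       ; _ (inj₂ new) → inj₂ new })
    (λ o o∈O ¬crit valid → inj₁ (o , (o∈O , ¬crit) , refl , valid))
    (λ _ → inj₂)
    (λ o o∈O → proj₁ (proj₁ (proj₁ wf o o∈O)))
    critical-invalid
    (requirements-image Rs (proj₂ wf))
    (λ g inG avoids → relabel-InG g inG avoids , relabel-avoids-new g)
    (λ g′ inG′ avoids → unrelabel-InG g′ inG′
                      , relabel-relabel δ f g′ (relabel-unrelabel g′ (proj₂ inG′) avoids))

γcol-spread : ∀ c S i j → γcol c S (i , j) ≡ (spread c (rowHasS? S j) i , j)
γcol-spread c S i j with <-cmp i c
... | tri< _ _ _ = refl
... | tri≈ _ _ _ with rowHasS? S j
...   | true  = refl
...   | false = refl
γcol-spread c S i j | tri> _ _ _ = refl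

module ColSeparation (t u : ℕ) (O : List GP) (Rs : List (List GP)) (c : ℕ) (S : List Cell)
  (wf : WellFormed t u O Rs) (c<t : c < t)
  (S⊆col : ColSubset (listTiling t u O Rs) c S)
  (separated : ColSepApplies (listTiling t u O Rs) c S) where

  open LineMembership row S

  𝒯 𝒯′ : Tiling
  𝒯  = listTiling t u O Rs
  𝒯′ = colSeparate 𝒯 c S

  f δ : Cell → Cell
  f = γcol c S
  δ (i , j) = (merge c i , j)

  col-f : ∀ x → col (f x) ≡ spread c (occupied (row x)) (col x)
  col-f (i , j) = cong col (γcol-spread c S i j)

  row-f : ∀ x → row (f x) ≡ row x
  row-f (i , j) = cong row (γcol-spread c S i j)

  δ∘f≗id : ∀ x → δ (f x) ≡ x
  δ∘f≗id (i , j) = trans (cong δ (γcol-spread c S i j)) (cong (_, j) (merge-spread c _ i))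

  occupied⇒∈S : ∀ y → col y ≡ c → occupied (row y) ≡ true → y ∈ S
  occupied⇒∈S y cy≡c occ with find (true⇒occupied occ)
  ... | s , s∈S , rs≡ry =
    subst (_∈ S) (cong₂ _,_ (trans (proj₁ (proj₂ S⊆col s s∈S)) (sym cy≡c)) rs≡ry) s∈S

  rest⇒unoccupied : ∀ x → col x ≡ c → x ∉ S → occupied (row x) ≡ false
  rest⇒unoccupied x cx≡c x∉S = occupied-false (λ a → x∉S (occupied⇒∈S x cx≡c (occupied-true a)))

  ∈S⇒col-f : ∀ x → x ∈ S → col (f x) ≡ c
  ∈S⇒col-f x x∈S = begin
    col (f x)                                ≡⟨ col-f x ⟩
    spread c (occupied (row x)) (col x)      ≡⟨ cong₂ (spread c) (∈⇒occupied x∈S) (proj₁ (proj₂ S⊆col x x∈S)) ⟩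
    spread c true c                          ≡⟨ spread-≡ c true ⟩
    c                                        ∎
    where open ≡-Reasoning

  rest⇒col-f : ∀ x → InColRest 𝒯 c S x → col (f x) ≡ suc c
  rest⇒col-f x (cx≡c , _ , _ , x∉S) = begin
    col (f x)                                ≡⟨ col-f x ⟩
    spread c (occupied (row x)) (col x)      ≡⟨ cong₂ (spread c) (rest⇒unoccupied x cx≡c x∉S) cx≡c ⟩
    spread c false c                         ≡⟨ spread-≡ c false ⟩
    suc c                                    ∎
    where open ≡-Reasoning

  critical-invalid : ∀ o → ColCritical 𝒯 c S o → ¬ Valid (relabel f o)
  critical-invalid _ (c₁ , c₂ , c₁∈S , rest , inj₁ (_ , refl)) (_ , colsOrdered , _) =
    <-irrefl refl (subst₂ _≤_ (rest⇒col-f c₂ rest) (∈S⇒col-f c₁ c₁∈S)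
                              (colsOrdered Fin.zero (Fin.suc Fin.zero) (s≤s z≤n)))
  critical-invalid _ (c₁ , c₂ , c₁∈S , rest , inj₂ (_ , refl)) (_ , colsOrdered , _) =
    <-irrefl refl (subst₂ _≤_ (rest⇒col-f c₂ rest) (∈S⇒col-f c₁ c₁∈S)
                              (colsOrdered Fin.zero (Fin.suc Fin.zero) (s≤s z≤n)))

  ¬rest-left-of-S : ∀ g → InG t u g → Avoids (obs 𝒯) g →
                    ∀ i j → i Fin.< j → col (c⟨ g ⟩ i) ≡ c → col (c⟨ g ⟩ j) ≡ c →
                    occupied (row (c⟨ g ⟩ i)) ≡ false → occupied (row (c⟨ g ⟩ j)) ≡ true → ⊥
  ¬rest-left-of-S g ((π-inj , _ , rowsOrdered) , box) avoids i j i<j ci≡c cj≡c unocc occ =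
    compareRows (position (row y) (row x))
    where
    x y : Cell
    x = c⟨ g ⟩ i
    y = c⟨ g ⟩ j
    y∈S : y ∈ S
    y∈S = occupied⇒∈S y cj≡c occ
    x∉S : x ∉ S
    x∉S x∈S = false⇒unoccupied unocc (Any.map (λ x≡s → cong row (sym x≡s)) x∈S)
    rest : InColRest 𝒯 c S x
    rest = ci≡c , proj₂ (box i) , (λ empty → avoids (point x) empty (point-≼ g i)) , x∉S
    compareRows : Position (row y) (row x) → ⊥
    compareRows (below ry<rx) with Finₚ.<-cmp (π⟨ g ⟩ i) (π⟨ g ⟩ j)
    ... | tri< πi<πj _ _ = <⇒≱ ry<rx (rowsOrdered i j πi<πj)
    ... | tri≈ _ πi≡πj _ = Finₚ.<-irrefl (π-inj i j πi≡πj) i<j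
    ... | tri> _ _ πj<πi = avoids (pat21 x y) (proj₁ (separated y x y∈S rest) ry<rx) (pat21-≼ g i j i<j πj<πi)
    compareRows (at ry≡rx) = x∉S (subst (_∈ S) (cong₂ _,_ (trans cj≡c (sym ci≡c)) ry≡rx) y∈S)
    compareRows (above rx<ry) with Finₚ.<-cmp (π⟨ g ⟩ i) (π⟨ g ⟩ j)
    ... | tri< πi<πj _ _ = avoids (pat12 x y) (proj₂ (separated y x y∈S rest) rx<ry) (pat12-≼ g i j i<j πi<πj)
    ... | tri≈ _ πi≡πj _ = Finₚ.<-irrefl (π-inj i j πi≡πj) i<j
    ... | tri> _ _ πj<πi = <⇒≱ rx<ry (rowsOrdered j i πj<πi)

  relabel-avoids-new : ∀ g → Avoids (ColNewObs u c S) (relabel f g)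
  relabel-avoids-new g o (inj₁ (j , _ , unocc , refl)) o≼fg =
    unocc (subst (λ j → Any (λ d → row d ≡ j) S) row≡j (true⇒occupied occ))
    where
    open _≼_ o≼fg
    e = emb Fin.zero
    fx≡ : f (c⟨ g ⟩ e) ≡ (c , j)
    fx≡ = trans (sym (lookup-relabel f g e)) (cellEq Fin.zero)
    row≡j : row (c⟨ g ⟩ e) ≡ j
    row≡j = trans (sym (row-f (c⟨ g ⟩ e))) (cong row fx≡)
    occ : occupied (row (c⟨ g ⟩ e)) ≡ true
    occ = spread≡r⇒kept c _ (col (c⟨ g ⟩ e)) (trans (sym (col-f (c⟨ g ⟩ e))) (cong col fx≡))
  relabel-avoids-new g o (inj₂ (j , occ , refl)) o≼fg =
    false⇒unoccupied (subst (λ j → occupied j ≡ false) row≡j unocc) occ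
    where
    open _≼_ o≼fg
    e = emb Fin.zero
    fx≡ : f (c⟨ g ⟩ e) ≡ (suc c , j)
    fx≡ = trans (sym (lookup-relabel f g e)) (cellEq Fin.zero)
    row≡j : row (c⟨ g ⟩ e) ≡ j
    row≡j = trans (sym (row-f (c⟨ g ⟩ e))) (cong row fx≡)
    unocc : occupied (row (c⟨ g ⟩ e)) ≡ false
    unocc = spread≡1+r⇒moved c _ (col (c⟨ g ⟩ e)) (trans (sym (col-f (c⟨ g ⟩ e))) (cong col fx≡))

  relabel-InG : ∀ g → InG t u g → Avoids (obs 𝒯) g → InG (suc t) u (relabel f g)
  relabel-InG g inG@((π-inj , colsOrdered , rowsOrdered) , box) avoids =
    (π-inj , colsOrdered′ , rowsOrdered′) , box′
    where
    col≡ : ∀ i → col (c⟨ relabel f g ⟩ i) ≡ spread c (occupied (row (c⟨ g ⟩ i))) (col (c⟨ g ⟩ i))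
    col≡ i = trans (cong col (lookup-relabel f g i)) (col-f (c⟨ g ⟩ i))
    row≡ : ∀ i → row (c⟨ relabel f g ⟩ i) ≡ row (c⟨ g ⟩ i)
    row≡ i = trans (cong row (lookup-relabel f g i)) (row-f (c⟨ g ⟩ i))
    colsOrdered′ : ∀ i j → i Fin.< j → col (c⟨ relabel f g ⟩ i) ≤ col (c⟨ relabel f g ⟩ j)
    colsOrdered′ i j i<j with spread-mono c _ _ (colsOrdered i j i<j)
    ... | inj₁ ≤′ = subst₂ _≤_ (sym (col≡ i)) (sym (col≡ j)) ≤′
    ... | inj₂ (ci≡c , cj≡c , unocc , occ) = ⊥-elim (¬rest-left-of-S g inG avoids i j i<j ci≡c cj≡c unocc occ)
    rowsOrdered′ : ∀ i j → π⟨ g ⟩ i Fin.< π⟨ g ⟩ j → row (c⟨ relabel f g ⟩ i) ≤ row (c⟨ relabel f g ⟩ j)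
    rowsOrdered′ i j πi<πj = subst₂ _≤_ (sym (row≡ i)) (sym (row≡ j)) (rowsOrdered i j πi<πj)
    box′ : InBox (suc t) u (relabel f g)
    box′ i = subst (_< suc t) (sym (col≡ i)) (≤-<-trans (spread-≤-suc c _ _) (s≤s (proj₁ (box i))))
           , subst (_< u) (sym (row≡ i)) (proj₂ (box i))

  relabel-unrelabel : ∀ g′ → InBox (suc t) u g′ → Avoids (ColNewObs u c S) g′ →
                      ∀ e → f (δ (c⟨ g′ ⟩ e)) ≡ c⟨ g′ ⟩ e
  relabel-unrelabel g′ box avoids e =
    trans (γcol-spread c S (merge c i) j) (cong (_, j) (spread-merge c (occupied j) i kept moved))
    where
    i = col (c⟨ g′ ⟩ e)
    j = row (c⟨ g′ ⟩ e)
    point-at : ∀ {k} → i ≡ k → point (k , j) ≼ g′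
    point-at refl = point-≼ g′ e
    kept : i ≡ c → occupied j ≡ true
    kept i≡c = ¬-not λ unocc →
      avoids (point (c , j)) (inj₁ (j , proj₂ (box e) , false⇒unoccupied unocc , refl)) (point-at i≡c)
    moved : i ≡ suc c → occupied j ≡ false
    moved i≡1+c = ¬-not λ occ →
      avoids (point (suc c , j)) (inj₂ (j , true⇒occupied occ , refl)) (point-at i≡1+c)

  unrelabel-InG : ∀ g′ → InG (suc t) u g′ → InG t u (relabel δ g′)
  unrelabel-InG g′ ((π-inj , colsOrdered , rowsOrdered) , box) = (π-inj , colsOrdered′ , rowsOrdered′) , box′
    where
    δ≡ : ∀ i → c⟨ relabel δ g′ ⟩ i ≡ δ (c⟨ g′ ⟩ i)
    δ≡ i = lookup-relabel δ g′ i
    colsOrdered′ : ∀ i j → i Fin.< j → col (c⟨ relabel δ g′ ⟩ i) ≤ col (c⟨ relabel δ g′ ⟩ j)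
    colsOrdered′ i j i<j =
      subst₂ _≤_ (sym (cong col (δ≡ i))) (sym (cong col (δ≡ j))) (merge-mono c (colsOrdered i j i<j))
    rowsOrdered′ : ∀ i j → π⟨ g′ ⟩ i Fin.< π⟨ g′ ⟩ j → row (c⟨ relabel δ g′ ⟩ i) ≤ row (c⟨ relabel δ g′ ⟩ j)
    rowsOrdered′ i j πi<πj =
      subst₂ _≤_ (sym (cong row (δ≡ i))) (sym (cong row (δ≡ j))) (rowsOrdered i j πi<πj)
    box′ : InBox t u (relabel δ g′)
    box′ i = subst (_< t) (sym (cong col (δ≡ i))) (merge-< c<t (proj₁ (box i)))
           , subst (_< u) (sym (cong row (δ≡ i))) (proj₂ (box i))

  requirements-image : ∀ Rs′ → (∀ R h → R ∈ Rs′ → h ∈ R → InG t u h) →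
    Pointwise (IsRelabelImage f) (reqs (listTiling t u O Rs′)) (reqs (colSeparate (listTiling t u O Rs′) c S))
  requirements-image []        _      = []
  requirements-image (R ∷ Rs′) inG-Rs = record
    { preimage = λ { _ (h , h∈R , refl , _) → h , h∈R , refl }
    ; image    = λ h h∈R valid → h , h∈R , refl , valid
    ; isPerm   = λ h h∈R → proj₁ (proj₁ (inG-Rs R h (here refl) h∈R))
    } ∷ requirements-image Rs′ (λ R′ h R′∈Rs′ → inG-Rs R′ h (there R′∈Rs′))

  inverse : ∀ n → Inverse (GridSetoid 𝒯 n) (GridSetoid 𝒯′ n)
  inverse = RelabellingInverse.inverse 𝒯 𝒯′ f δ δ∘f≗id (ColCritical 𝒯 c S) (ColNewObs u c S)
    (λ { _ (inj₁ (o₀ , (o₀∈O , _) , fo₀≡o , _)) → inj₁ (o₀ , o₀∈O , fo₀≡o)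
       ; _ (inj₂ new) → inj₂ new })
    (λ o o∈O ¬crit valid → inj₁ (o , (o∈O , ¬crit) , refl , valid))
    (λ _ → inj₂)
    (λ o o∈O → proj₁ (proj₁ (proj₁ wf o o∈O)))
    critical-invalid
    (requirements-image Rs (proj₂ wf))
    (λ g inG avoids → relabel-InG g inG avoids , relabel-avoids-new g)
    (λ g′ inG′ avoids → unrelabel-InG g′ inG′
                      , relabel-relabel δ f g′ (relabel-unrelabel g′ (proj₂ inG′) avoids))

theorem6p14 : ((t u : ℕ) (O : List GP) (Rs : List (List GP)) (r : ℕ) (S : List Cell) →
      WellFormed t u O Rs → Incomparable O → r < u →
      RowSubset (listTiling t u O Rs) r S →
      RowSepApplies (listTiling t u O Rs) r S →
      (n : ℕ) →
      Inverse (GridSetoid (listTiling t u O Rs) n)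
              (GridSetoid (rowSeparate (listTiling t u O Rs) r S) n))
    ×
    ((t u : ℕ) (O : List GP) (Rs : List (List GP)) (c : ℕ) (S : List Cell) →
      WellFormed t u O Rs → Incomparable O → c < t →
      ColSubset (listTiling t u O Rs) c S →
      ColSepApplies (listTiling t u O Rs) c S →
      (n : ℕ) →
      Inverse (GridSetoid (listTiling t u O Rs) n)
              (GridSetoid (colSeparate (listTiling t u O Rs) c S) n))
theorem6p14 =
  (λ t u O Rs r S wf _ r<u S⊆row sep → RowSeparation.inverse t u O Rs r S wf r<u S⊆row sep) ,
  (λ t u O Rs c S wf _ c<t S⊆col sep → ColSeparation.inverse t u O Rs c S wf c<t S⊆col sep)
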